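{- Let $k\geq3$, $n_1=\cdots=n_k\geq 2$, and let $G,G'\in\mathcal{O}(K_{n_1,\dots,n_k})$ with split decompositions $Q_0,Q_1,\dots,Q_k$ and $Q_0',Q_1',\dots,Q_k'$ respectively. Let $I\subseteq[k]$ be the set of indices $i\geq1$ for which $Q_i$ is star-spoke, and $I'\subseteq[k]$ the analogous set for $G'$. Suppose $G$ and $G'$ belong to the same symmetry class (both of type 1, both of type 2, or both of type 3, as defined below) and $|I|=|I'|$. Then $G$ and $G'$ are isomorphic.
   Context: Local complement $c_v(G)$: replace the subgraph induced on the neighbourhood of $v$ by its complement, leaving all other edges unchanged; $\mathcal{O}(G)$ is the set of graphs on the same labeled vertex set obtainable from $G$ by finite sequences of local complements. $K_{n_1,\dots,n_k}$ is the complete $k$-partite graph with parts $V_1,\dots,V_k$, $|V_i|=n_i$. Every $G\in\mathcal{O}(K_{n_1,\dots,n_k})$ is described by quotient graphs $Q_0,\dots,Q_k$: $Q_i$ ($i\geq1$) has vertex set $V_i$ plus one split-node $s_i$; $Q_0$ has split-nodes $t_1,\dots,t_k$; each is complete or a star; vertices of $V_i$ are adjacent in $G$ iff adjacent in $Q_i$, and $u\in V_i$, $v\in V_\ell$ ($i\neq\ell$) are adjacent iff $us_i\in E(Q_i)$, $t_it_\ell\in E(Q_0)$, $s_\ell v\in E(Q_\ell)$. $Q_i$ ($i\ge1$) is star-center if it is a star with center $s_i$ and star-spoke if it is a star with center a leaf-node. Symmetry classes: type 1: $Q_0$ complete; type 2: $Q_0$ is a star with center $t_j$ for some $j$, and $Q_j$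 is star-center; type 3: $Q_0$ is a star with center $t_j$ for some $j$, and $Q_j$ is complete (the index $j$ may differ between $G$ and $G'$). -}

module Defs where

open import Data.Nat using (ℕ)
open import Data.Bool using (Bool; true; false; not; _∧_; _∨_; if_then_else_)
open import Data.Fin using (Fin)
open import Data.Fin.Subset using (Subset)
open import Data.Product using (_×_; _,_; Σ; ∃)
open import Data.Sum using (_⊎_)
open import Data.List using (List; foldl)
open import Data.Vec using (tabulate)
open import Relation.Nullary using (¬_)
open import Relation.Nullary.Decidable using (⌊_⌋)
open import Relation.Binary.PropositionalEquality using (_≡_)
open import Function.Bundles using (_↔_; Inverse)
import Data.Fin.Properties as FinP
import Data.Product.Properties as ProdP

-- Vertex set of K_{n,...,n} (k parts of size n): vertex (i , u) is the
-- u-th vertex of part V_i.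
Vtx : ℕ → ℕ → Set
Vtx k n = Fin k × Fin n

Graph : Set → Set
Graph V = V → V → Bool

_≟V_ : ∀ {k n} (x y : Vtx k n) → Relation.Nullary.Dec (x ≡ y)
_≟V_ = ProdP.≡-dec FinP._≟_ FinP._≟_

_==V_ : ∀ {k n} → Vtx k n → Vtx k n → Bool
x ==V y = ⌊ x ≟V y ⌋

_==F_ : ∀ {m} → Fin m → Fin m → Bool
i ==F j = ⌊ i FinP.≟ j ⌋

localComp : ∀ {k n} → Vtx k n → Graph (Vtx k n) → Graph (Vtx k n)
localComp v G x y =
  if not (x ==V y) ∧ G v x ∧ G v y then not (G x y) else G x y

localComps : ∀ {k n} → List (Vtx k n) → Graph (Vtx k n) → Graph (Vtx k n)
localComps vs G = foldl (λ H v → localComp v H) G vs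

InOrbit : ∀ {k n} → Graph (Vtx k n) → Graph (Vtx k n) → Set
InOrbit {k} {n} H G =
  Σ (List (Vtx k n)) λ vs → ∀ x y → G x y ≡ localComps vs H x y

completeMultipartite : (k n : ℕ) → Graph (Vtx k n)
completeMultipartite k n (i , _) (j , _) = not (i ==F j)

Isomorphic : ∀ {k n} → Graph (Vtx k n) → Graph (Vtx k n) → Set
Isomorphic {k} {n} G G' =
  Σ (Vtx k n ↔ Vtx k n) λ f →
    ∀ x y → G x y ≡ G' (Inverse.to f x) (Inverse.to f y)

-- Shape of Q_0 (vertex set {t_1,…,t_k}): complete, or a star with centre t_j.
data Q0Shape (k : ℕ) : Set where
  complete : Q0Shape k
  star     : Fin k → Q0Shape k

-- Shape of Q_i, i ≥ 1 (vertex set V_i ∪ {s_i}): complete,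
-- star-center (star with centre s_i), or star-spoke (star with centre
-- the leaf-node c ∈ V_i).
data QShape (n : ℕ) : Set where
  complete   : QShape n
  starCenter : QShape n
  starSpoke  : Fin n → QShape n

leafAdj : ∀ {n} → QShape n → Fin n → Fin n → Bool
leafAdj complete      u v = true
leafAdj starCenter    u v = false
leafAdj (starSpoke c) u v = (u ==F c) ∨ (v ==F c)

splitAdj : ∀ {n} → QShape n → Fin n → Bool
splitAdj complete      u = true
splitAdj starCenter    u = true
splitAdj (starSpoke c) u = u ==F c

q0Adj : ∀ {k} → Q0Shape k → Fin k → Fin k → Bool
q0Adj complete i l = true
q0Adj (star j) i l = (i ==F j) ∨ (l ==F j)

record SplitDecomp (k n : ℕ) : Set where
  constructor decomp
  field
    Q0 : Q0Shape k
    Q  : Fin k → QShape n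
open SplitDecomp public

decompAdj : ∀ {k n} → SplitDecomp k n → Graph (Vtx k n)
decompAdj D (i , u) (l , v) =
  if i ==F l
  then leafAdj (Q D i) u v
  else splitAdj (Q D i) u ∧ q0Adj (Q0 D) i l ∧ splitAdj (Q D l) v

Describes : ∀ {k n} → SplitDecomp k n → Graph (Vtx k n) → Set
Describes {k} {n} D G = ∀ (x y : Vtx k n) → ¬ (x ≡ y) → G x y ≡ decompAdj D x y

isSpoke : ∀ {n} → QShape n → Bool
isSpoke (starSpoke _) = true
isSpoke _             = false

spokeSet : ∀ {k n} → SplitDecomp k n → Subset k
spokeSet D = tabulate (λ i → isSpoke (Q D i))

Type1 : ∀ {k n} → SplitDecomp k n → Set
Type1 D = Q0 D ≡ complete

Type2 : ∀ {k n} → SplitDecomp k n → Set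
Type2 D = ∃ λ j → (Q0 D ≡ star j) × (Q D j ≡ starCenter)

Type3 : ∀ {k n} → SplitDecomp k n → Set
Type3 D = ∃ λ j → (Q0 D ≡ star j) × (Q D j ≡ complete)

SameClass : ∀ {k n} → SplitDecomp k n → SplitDecomp k n → Set
SameClass D D' = (Type1 D × Type1 D') ⊎ (Type2 D × Type2 D') ⊎ (Type3 D × Type3 D')

-- Every graph in the orbit of K_{n,…,n} is described by a reduced split decomposition, one in
-- which no tree edge joins two cliques or the centre of one star to a leaf of another.  Indeed
-- K_{n,…,n} is described by a complete Q_0 and stars Q_i centred at s_i, and a local
-- complementation at c ∈ V_a acts on a decomposition by locally complementing quotient graphs:
-- Q_a at c and, when c is adjacent to s_a, also Q_0 at t_a and, at s_l, each Q_l with t_l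
-- adjacent to t_a; this keeps the decomposition reduced.  For k ≥ 3 and n ≥ 2 a graph has only
-- one decomposition, so the given D and D' are reduced.  Away from the centre of Q_0,
-- reducedness leaves a single shape that is not star-spoke, so a permutation of the parts
-- matching the star-spoke parts (and the centres of Q_0), combined with a transposition of the
-- star centres inside each star-spoke part, is an isomorphism G ≅ G'.

module Submission where

open import Defs
open import Data.Bool using (Bool; true; false; not; _∧_; _∨_; _xor_; if_then_else_; T)
open import Data.Bool.Properties using (∨-comm; ∧-conicalˡ; ∧-identityʳ; ⇔→≡)
open import Data.Bool.Solver using (module xor-∧-Solver)
open import Data.Empty using (⊥-elim)
open import Data.Fin using (Fin; zero; suc; punchIn; punchOut)
open import Data.Fin.Permutation as Perm using (Permutation; _⟨$⟩ʳ_)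
open import Data.Fin.Properties using (_≟_; punchInᵢ≢i; punchIn-injective; punchIn-punchOut)
open import Data.Fin.Subset using (Subset; ∣_∣)
open import Data.Fin.Subset.Properties using (∣p∣≤n)
open import Data.List using (List; []; _∷_)
open import Data.Nat using (ℕ; _≤_; _<_; s≤s; z≤n; s<s⁻¹)
open import Data.Nat.Properties using (≤-trans; suc-injective)
open import Data.Product using (Σ; _×_; _,_; proj₁; proj₂)
open import Data.Product.Function.Dependent.Propositional using (Σ-↔)
open import Data.Sum using (inj₁; inj₂)
open import Data.Unit using (tt)
open import Data.Vec using (_∷_; tabulate)
open import Function using (_∘_; flip)
open import Function.Bundles using (mk⇔; _↔_; Inverse; Injection)
open import Function.Properties.Inverse using (↔⇒↣)
open import Relation.Binary.PropositionalEquality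
open import Relation.Nullary using (yes; no; Dec; contradiction)

open xor-∧-Solver using (solve; _:=_; _:+_; _:*_)

private variable
  k n m : ℕ

open ≡-Reasoning

==F-refl : (i : Fin m) → (i ==F i) ≡ true
==F-refl i with i ≟ i
... | yes _ = refl
... | no i≢i = ⊥-elim (i≢i refl)

==F-≢ : {i j : Fin m} → i ≢ j → (i ==F j) ≡ false
==F-≢ {i = i} {j} i≢j with i ≟ j
... | yes i≡j = ⊥-elim (i≢j i≡j)
... | no _ = refl

==F⇒≡ : {i j : Fin m} → (i ==F j) ≡ true → i ≡ j
==F⇒≡ {i = i} {j} eq with i ≟ j
... | yes i≡j = i≡j

==V-refl : (x : Vtx k n) → (x ==V x) ≡ true
==V-refl x with x ≟V x
... | yes _ = refl
... | no x≢x = ⊥-elim (x≢x refl)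

==V-≢ : {x y : Vtx k n} → x ≢ y → (x ==V y) ≡ false
==V-≢ {x = x} {y} x≢y with x ≟V y
... | yes x≡y = ⊥-elim (x≢y x≡y)
... | no _ = refl

graphOf : SplitDecomp k n → Graph (Vtx k n)
graphOf D x y = if x ==V y then false else decompAdj D x y

graphOf-diag : (D : SplitDecomp k n) (x : Vtx k n) → graphOf D x x ≡ false
graphOf-diag D x rewrite ==V-refl x = refl

graphOf-≢ : (D : SplitDecomp k n) {x y : Vtx k n} → x ≢ y → graphOf D x y ≡ decompAdj D x y
graphOf-≢ D x≢y rewrite ==V-≢ x≢y = refl

graphOf-crossPart : (D : SplitDecomp k n) {i l : Fin k} (u v : Fin n) → i ≢ l →
  graphOf D (i , u) (l , v) ≡ splitAdj (Q D i) u ∧ q0Adj (Q0 D) i l ∧ splitAdj (Q D l) v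
graphOf-crossPart D u v i≢l
  rewrite graphOf-≢ D {_ , u} {_ , v} (i≢l ∘ cong proj₁) | ==F-≢ i≢l = refl

graphOf-samePart-≢ : (D : SplitDecomp k n) (i : Fin k) {u v : Fin n} → u ≢ v →
  graphOf D (i , u) (i , v) ≡ leafAdj (Q D i) u v
graphOf-samePart-≢ D i u≢v
  rewrite graphOf-≢ D {i , _} {i , _} (u≢v ∘ cong proj₂) | ==F-refl i = refl

leafEdge : QShape n → Fin n → Fin n → Bool
leafEdge R c u = not (u ==F c) ∧ leafAdj R c u

graphOf-samePart : (D : SplitDecomp k n) (i : Fin k) (u v : Fin n) →
  graphOf D (i , u) (i , v) ≡ leafEdge (Q D i) u v
graphOf-samePart D i u v with u ≟ v
... | yes refl rewrite graphOf-diag D (i , u) | ==F-refl u = refl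
... | no u≢v rewrite graphOf-samePart-≢ D i u≢v | ==F-≢ (u≢v ∘ sym) = refl

-- Local complementation of split decompositions

complementLeaf : Fin n → QShape n → QShape n
complementLeaf c complete       = starSpoke c
complementLeaf c starCenter     = starCenter
complementLeaf c (starSpoke c′) = if c ==F c′ then complete else starSpoke c′

complementSplit : QShape n → QShape n
complementSplit complete      = starCenter
complementSplit starCenter    = complete
complementSplit (starSpoke c) = starSpoke c

complementQ0 : Fin k → Q0Shape k → Q0Shape k
complementQ0 a complete = star a
complementQ0 a (star j) = if j ==F a then complete else star j

leafAdj-complementLeaf : (c : Fin n) (R : QShape n) {u v : Fin n} → u ≢ v →
  leafAdj (complementLeaf c R) u v ≡ (leafEdge R c u ∧ leafEdge R c v) xor leafAdj R u v
leafAdj-complementLeaf c complete {u} {v} u≢v with u ≟ c | v ≟ c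
... | yes refl | yes refl = ⊥-elim (u≢v refl)
... | yes refl | no _ = refl
... | no _ | yes refl = refl
... | no _ | no _ = refl
leafAdj-complementLeaf c starCenter {u} u≢v with u ≟ c
... | yes _ = refl
... | no _ = refl
leafAdj-complementLeaf c (starSpoke c′) {u} {v} u≢v with c ≟ c′
... | yes refl with u ≟ c | v ≟ c
...   | yes refl | yes refl = ⊥-elim (u≢v refl)
...   | yes refl | no _ = refl
...   | no _ | yes refl = refl
...   | no _ | no _ = refl
leafAdj-complementLeaf c (starSpoke c′) {u} {v} u≢v | no c≢c′
  with u ≟ c′ | v ≟ c′ | u ≟ c | v ≟ c
...   | yes refl | yes refl | _        | _        = ⊥-elim (u≢v refl)
...   | yes refl | no _     | yes refl | _        = ⊥-elim (c≢c′ refl)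
...   | no _     | yes refl | _        | yes refl = ⊥-elim (c≢c′ refl)
...   | yes refl | no _     | no _     | yes _    = refl
...   | yes refl | no _     | no _     | no _     = refl
...   | no _     | yes refl | yes _    | no _     = refl
...   | no _     | yes refl | no _     | no _     = refl
...   | no _     | no _     | yes _    | _        = refl
...   | no _     | no _     | no _     | _        = refl

splitAdj-complementLeaf : (c : Fin n) (R : QShape n) (u : Fin n) →
  splitAdj (complementLeaf c R) u ≡ (leafEdge R c u ∧ splitAdj R c) xor splitAdj R u
splitAdj-complementLeaf c complete u with u ≟ c
... | yes refl = refl
... | no _ = refl
splitAdj-complementLeaf c starCenter u with u ≟ c
... | yes refl = refl
... | no _ = refl
splitAdj-complementLeaf c (starSpoke c′) u with c ≟ c′
... | yes refl with u ≟ c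
...   | yes refl = refl
...   | no _ = refl
splitAdj-complementLeaf c (starSpoke c′) u | no c≢c′ with u ≟ c′ | u ≟ c
...   | yes refl | yes refl = ⊥-elim (c≢c′ refl)
...   | yes refl | no _ = refl
...   | no _ | yes _ = refl
...   | no _ | no _ = refl

leafAdj-complementSplit : (t : Bool) (R : QShape n) {u v : Fin n} → u ≢ v →
  leafAdj (if t then complementSplit R else R) u v ≡
  (t ∧ splitAdj R u ∧ splitAdj R v) xor leafAdj R u v
leafAdj-complementSplit false R u≢v = refl
leafAdj-complementSplit true complete u≢v = refl
leafAdj-complementSplit true starCenter u≢v = refl
leafAdj-complementSplit true (starSpoke c) {u} {v} u≢v with u ≟ c | v ≟ c
... | yes refl | yes refl = ⊥-elim (u≢v refl)
... | yes refl | no _ = refl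
... | no _ | yes _ = refl
... | no _ | no _ = refl

splitAdj-complementSplit : (t : Bool) (R : QShape n) (u : Fin n) →
  splitAdj (if t then complementSplit R else R) u ≡ splitAdj R u
splitAdj-complementSplit false R u = refl
splitAdj-complementSplit true complete u = refl
splitAdj-complementSplit true starCenter u = refl
splitAdj-complementSplit true (starSpoke c) u = refl

q0Adj-sym : (P : Q0Shape k) (i l : Fin k) → q0Adj P i l ≡ q0Adj P l i
q0Adj-sym complete i l = refl
q0Adj-sym (star j) i l = ∨-comm (i ==F j) (l ==F j)

q0Adj-complementQ0-pivot : (t : Bool) (a : Fin k) (P : Q0Shape k) {l : Fin k} → l ≢ a →
  q0Adj (if t then complementQ0 a P else P) a l ≡ q0Adj P a l
q0Adj-complementQ0-pivot false a P l≢a = refl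
q0Adj-complementQ0-pivot true a complete l≢a rewrite ==F-refl a = refl
q0Adj-complementQ0-pivot true a (star j) l≢a with j ≟ a
... | yes refl rewrite ==F-refl j = refl
... | no _ = refl

q0Adj-complementQ0 : (t : Bool) (a : Fin k) (P : Q0Shape k) {i l : Fin k} →
  i ≢ l → i ≢ a → l ≢ a →
  q0Adj (if t then complementQ0 a P else P) i l ≡ (t ∧ q0Adj P a i ∧ q0Adj P a l) xor q0Adj P i l
q0Adj-complementQ0 false a P i≢l i≢a l≢a = refl
q0Adj-complementQ0 true a complete i≢l i≢a l≢a rewrite ==F-≢ i≢a | ==F-≢ l≢a = refl
q0Adj-complementQ0 true a (star j) {i} {l} i≢l i≢a l≢a with j ≟ a
... | yes refl rewrite ==F-refl j | ==F-≢ i≢a | ==F-≢ l≢a = refl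
... | no j≢a rewrite ==F-≢ (j≢a ∘ sym) with i ≟ j | l ≟ j
...   | yes refl | yes refl = ⊥-elim (i≢l refl)
...   | yes _ | no _ = refl
...   | no _ | yes _ = refl
...   | no _ | no _ = refl

localComp-diag : (G : Graph (Vtx k n)) (w x : Vtx k n) → localComp w G x x ≡ G x x
localComp-diag G w x rewrite ==V-refl x = refl

localComp-≢ : (G : Graph (Vtx k n)) (w : Vtx k n) {x y : Vtx k n} → x ≢ y →
  localComp w G x y ≡ (G w x ∧ G w y) xor G x y
localComp-≢ G w {x} {y} x≢y rewrite ==V-≢ x≢y with G w x ∧ G w y
... | true = refl
... | false = refl

localComp-cong : (w : Vtx k n) {H H′ : Graph (Vtx k n)} → (∀ x y → H x y ≡ H′ x y) →
  ∀ x y → localComp w H x y ≡ localComp w H′ x y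
localComp-cong w H≡H′ x y rewrite H≡H′ w x | H≡H′ w y | H≡H′ x y = refl

localCompDecomp : Vtx k n → SplitDecomp k n → SplitDecomp k n
localCompDecomp (a , c) D =
  decomp (if linked then complementQ0 a (Q0 D) else Q0 D)
         (λ l → if l ==F a then complementLeaf c (Q D a)
                else if linked ∧ q0Adj (Q0 D) a l then complementSplit (Q D l) else Q D l)
  where linked = splitAdj (Q D a) c

module LocalCompAt (a : Fin k) (c : Fin n) (D : SplitDecomp k n) where

  D′ : SplitDecomp k n
  D′ = localCompDecomp (a , c) D

  linked : Bool
  linked = splitAdj (Q D a) c

  G G′ : Graph (Vtx k n)
  G = localComp (a , c) (graphOf D)
  G′ = graphOf D′

  Q′-pivot : Q D′ a ≡ complementLeaf c (Q D a)
  Q′-pivot rewrite ==F-refl a = refl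

  Q′-away : {l : Fin k} → l ≢ a →
    Q D′ l ≡ (if linked ∧ q0Adj (Q0 D) a l then complementSplit (Q D l) else Q D l)
  Q′-away l≢a rewrite ==F-≢ l≢a = refl

  splitAdj-away : {l : Fin k} → l ≢ a → (v : Fin n) → splitAdj (Q D′ l) v ≡ splitAdj (Q D l) v
  splitAdj-away {l} l≢a v rewrite Q′-away l≢a =
    splitAdj-complementSplit (linked ∧ q0Adj (Q0 D) a l) (Q D l) v

  splitAdj-pivot : (u : Fin n) →
    splitAdj (Q D′ a) u ≡ (leafEdge (Q D a) c u ∧ linked) xor splitAdj (Q D a) u
  splitAdj-pivot u rewrite Q′-pivot = splitAdj-complementLeaf c (Q D a) u


  pivotPart : {u v : Fin n} → u ≢ v → G (a , u) (a , v) ≡ G′ (a , u) (a , v)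
  pivotPart {u} {v} u≢v = begin
    G (a , u) (a , v)
      ≡⟨ localComp-≢ (graphOf D) (a , c) (u≢v ∘ cong proj₂) ⟩
    (graphOf D (a , c) (a , u) ∧ graphOf D (a , c) (a , v)) xor graphOf D (a , u) (a , v)
      ≡⟨ cong₂ _xor_ (cong₂ _∧_ (graphOf-samePart D a c u) (graphOf-samePart D a c v))
                     (graphOf-samePart-≢ D a u≢v) ⟩
    (leafEdge (Q D a) c u ∧ leafEdge (Q D a) c v) xor leafAdj (Q D a) u v
      ≡⟨ sym (leafAdj-complementLeaf c (Q D a) u≢v) ⟩
    leafAdj (complementLeaf c (Q D a)) u v
      ≡⟨ cong (λ R → leafAdj R u v) (sym Q′-pivot) ⟩
    leafAdj (Q D′ a) u v
      ≡⟨ sym (graphOf-samePart-≢ D′ a u≢v) ⟩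
    G′ (a , u) (a , v) ∎

  otherPart : {i : Fin k} {u v : Fin n} → i ≢ a → u ≢ v → G (i , u) (i , v) ≡ G′ (i , u) (i , v)
  otherPart {i} {u} {v} i≢a u≢v = begin
    G (i , u) (i , v)
      ≡⟨ localComp-≢ (graphOf D) (a , c) (u≢v ∘ cong proj₂) ⟩
    (graphOf D (a , c) (i , u) ∧ graphOf D (a , c) (i , v)) xor graphOf D (i , u) (i , v)
      ≡⟨ cong₂ _xor_ (cong₂ _∧_ (graphOf-crossPart D c u a≢i) (graphOf-crossPart D c v a≢i))
                     (graphOf-samePart-≢ D i u≢v) ⟩
    ((linked ∧ q ∧ Su) ∧ (linked ∧ q ∧ Sv)) xor leafAdj (Q D i) u v
      ≡⟨ cong (_xor leafAdj (Q D i) u v) (∧-∧-share linked q Su Sv) ⟩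
    ((linked ∧ q) ∧ Su ∧ Sv) xor leafAdj (Q D i) u v
      ≡⟨ sym (leafAdj-complementSplit (linked ∧ q) (Q D i) u≢v) ⟩
    leafAdj (if linked ∧ q then complementSplit (Q D i) else Q D i) u v
      ≡⟨ cong (λ R → leafAdj R u v) (sym (Q′-away i≢a)) ⟩
    leafAdj (Q D′ i) u v
      ≡⟨ sym (graphOf-samePart-≢ D′ i u≢v) ⟩
    G′ (i , u) (i , v) ∎
    where
    a≢i = i≢a ∘ sym
    q = q0Adj (Q0 D) a i
    Su = splitAdj (Q D i) u
    Sv = splitAdj (Q D i) v
    ∧-∧-share : ∀ s q x y → (s ∧ q ∧ x) ∧ (s ∧ q ∧ y) ≡ (s ∧ q) ∧ x ∧ y
    ∧-∧-share true true x y = refl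
    ∧-∧-share true false x y = refl
    ∧-∧-share false q x y = refl

  fromPivot : {l : Fin k} {u v : Fin n} → l ≢ a → G (a , u) (l , v) ≡ G′ (a , u) (l , v)
  fromPivot {l} {u} {v} l≢a = begin
    G (a , u) (l , v)
      ≡⟨ localComp-≢ (graphOf D) (a , c) (a≢l ∘ cong proj₁) ⟩
    (graphOf D (a , c) (a , u) ∧ graphOf D (a , c) (l , v)) xor graphOf D (a , u) (l , v)
      ≡⟨ cong₂ _xor_ (cong₂ _∧_ (graphOf-samePart D a c u) (graphOf-crossPart D c v a≢l))
                     (graphOf-crossPart D u v a≢l) ⟩
    (leafEdge (Q D a) c u ∧ linked ∧ q ∧ Sv) xor (Su ∧ q ∧ Sv)
      ≡⟨ factor (leafEdge (Q D a) c u) linked q Su Sv ⟩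
    ((leafEdge (Q D a) c u ∧ linked) xor Su) ∧ q ∧ Sv
      ≡⟨ cong₂ _∧_ (sym (splitAdj-pivot u))
           (cong₂ _∧_ (sym (q0Adj-complementQ0-pivot linked a (Q0 D) l≢a))
                      (sym (splitAdj-away l≢a v))) ⟩
    splitAdj (Q D′ a) u ∧ q0Adj (Q0 D′) a l ∧ splitAdj (Q D′ l) v
      ≡⟨ sym (graphOf-crossPart D′ u v a≢l) ⟩
    G′ (a , u) (l , v) ∎
    where
    a≢l = l≢a ∘ sym
    q = q0Adj (Q0 D) a l
    Su = splitAdj (Q D a) u
    Sv = splitAdj (Q D l) v
    factor : ∀ e s q x y → (e ∧ s ∧ q ∧ y) xor (x ∧ q ∧ y) ≡ ((e ∧ s) xor x) ∧ q ∧ y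
    factor = solve 5 (λ e s q x y → (e :* (s :* (q :* y))) :+ (x :* (q :* y))
                                   := ((e :* s) :+ x) :* (q :* y)) refl

  toPivot : {i : Fin k} {u v : Fin n} → i ≢ a → G (i , u) (a , v) ≡ G′ (i , u) (a , v)
  toPivot {i} {u} {v} i≢a = begin
    G (i , u) (a , v)
      ≡⟨ localComp-≢ (graphOf D) (a , c) (i≢a ∘ cong proj₁) ⟩
    (graphOf D (a , c) (i , u) ∧ graphOf D (a , c) (a , v)) xor graphOf D (i , u) (a , v)
      ≡⟨ cong₂ _xor_ (cong₂ _∧_ (graphOf-crossPart D c u (i≢a ∘ sym)) (graphOf-samePart D a c v))
                     (graphOf-crossPart D u v i≢a) ⟩
    ((linked ∧ q0Adj (Q0 D) a i ∧ Su) ∧ leafEdge (Q D a) c v) xor (Su ∧ q ∧ Sv)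
      ≡⟨ cong (λ p → ((linked ∧ p ∧ Su) ∧ leafEdge (Q D a) c v) xor (Su ∧ q ∧ Sv))
              (q0Adj-sym (Q0 D) a i) ⟩
    ((linked ∧ q ∧ Su) ∧ leafEdge (Q D a) c v) xor (Su ∧ q ∧ Sv)
      ≡⟨ factor linked q Su (leafEdge (Q D a) c v) Sv ⟩
    Su ∧ q ∧ ((leafEdge (Q D a) c v ∧ linked) xor Sv)
      ≡⟨ cong₂ _∧_ (sym (splitAdj-away i≢a u)) (cong₂ _∧_ (sym q′) (sym (splitAdj-pivot v))) ⟩
    splitAdj (Q D′ i) u ∧ q0Adj (Q0 D′) i a ∧ splitAdj (Q D′ a) v
      ≡⟨ sym (graphOf-crossPart D′ u v i≢a) ⟩
    G′ (i , u) (a , v) ∎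
    where
    q = q0Adj (Q0 D) i a
    Su = splitAdj (Q D i) u
    Sv = splitAdj (Q D a) v
    q′ : q0Adj (Q0 D′) i a ≡ q
    q′ = trans (q0Adj-sym (Q0 D′) i a)
           (trans (q0Adj-complementQ0-pivot linked a (Q0 D) i≢a) (q0Adj-sym (Q0 D) a i))
    factor : ∀ s q x e y → ((s ∧ q ∧ x) ∧ e) xor (x ∧ q ∧ y) ≡ x ∧ q ∧ ((e ∧ s) xor y)
    factor = solve 5 (λ s q x e y → ((s :* (q :* x)) :* e) :+ (x :* (q :* y))
                                   := x :* (q :* ((e :* s) :+ y))) refl

  awayFromPivot : {i l : Fin k} {u v : Fin n} → i ≢ l → i ≢ a → l ≢ a →
    G (i , u) (l , v) ≡ G′ (i , u) (l , v)
  awayFromPivot {i} {l} {u} {v} i≢l i≢a l≢a = begin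
    G (i , u) (l , v)
      ≡⟨ localComp-≢ (graphOf D) (a , c) (i≢l ∘ cong proj₁) ⟩
    (graphOf D (a , c) (i , u) ∧ graphOf D (a , c) (l , v)) xor graphOf D (i , u) (l , v)
      ≡⟨ cong₂ _xor_ (cong₂ _∧_ (graphOf-crossPart D c u (i≢a ∘ sym))
                                (graphOf-crossPart D c v (l≢a ∘ sym)))
                     (graphOf-crossPart D u v i≢l) ⟩
    ((linked ∧ qai ∧ Su) ∧ (linked ∧ qal ∧ Sv)) xor (Su ∧ qil ∧ Sv)
      ≡⟨ factor linked qai qal qil Su Sv ⟩
    Su ∧ ((linked ∧ qai ∧ qal) xor qil) ∧ Sv
      ≡⟨ cong₂ _∧_ (sym (splitAdj-away i≢a u))
           (cong₂ _∧_ (sym (q0Adj-complementQ0 linked a (Q0 D) i≢l i≢a l≢a))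
                      (sym (splitAdj-away l≢a v))) ⟩
    splitAdj (Q D′ i) u ∧ q0Adj (Q0 D′) i l ∧ splitAdj (Q D′ l) v
      ≡⟨ sym (graphOf-crossPart D′ u v i≢l) ⟩
    G′ (i , u) (l , v) ∎
    where
    qai = q0Adj (Q0 D) a i
    qal = q0Adj (Q0 D) a l
    qil = q0Adj (Q0 D) i l
    Su = splitAdj (Q D i) u
    Sv = splitAdj (Q D l) v
    factor : ∀ s x y q u v →
      ((s ∧ x ∧ u) ∧ (s ∧ y ∧ v)) xor (u ∧ q ∧ v) ≡ u ∧ ((s ∧ x ∧ y) xor q) ∧ v
    factor false x y q u v = refl
    factor true = solve 5 (λ x y q u v → ((x :* u) :* (y :* v)) :+ (u :* (q :* v))
                                        := u :* (((x :* y) :+ q) :* v)) refl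

  byCases : ∀ i u l v → Dec (i ≡ l) → Dec (u ≡ v) → Dec (i ≡ a) → Dec (l ≡ a) →
    G (i , u) (l , v) ≡ G′ (i , u) (l , v)
  byCases i u i u (yes refl) (yes refl) _ _ =
    trans (localComp-diag (graphOf D) (a , c) (i , u))
          (trans (graphOf-diag D (i , u)) (sym (graphOf-diag D′ (i , u))))
  byCases a u a v (yes refl) (no u≢v) (yes refl) _ = pivotPart u≢v
  byCases i u i v (yes refl) (no u≢v) (no i≢a) _ = otherPart i≢a u≢v
  byCases a u a v (no a≢a) _ (yes refl) (yes refl) = ⊥-elim (a≢a refl)
  byCases a u l v (no a≢l) _ (yes refl) (no l≢a) = fromPivot l≢a
  byCases i u a v (no i≢a) _ (no _) (yes refl) = toPivot i≢a
  byCases i u l v (no i≢l) _ (no i≢a) (no l≢a) = awayFromPivot i≢l i≢a l≢a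

localComp-graphOf : (w : Vtx k n) (D : SplitDecomp k n) (x y : Vtx k n) →
  localComp w (graphOf D) x y ≡ graphOf (localCompDecomp w D) x y
localComp-graphOf (a , c) D (i , u) (l , v) = byCases i u l v (i ≟ l) (u ≟ v) (i ≟ a) (l ≟ a)
  where open LocalCompAt a c D

-- Reduced decompositions

-- marker (Q D i) is the role of s_i in Q_i and q0Marker (Q0 D) i that of t_i in Q_0; Reduced says
-- that the two ends of each tree edge s_i t_i are compatible.
data Marker : Set where
  clique centre leaf : Marker

marker : QShape n → Marker
marker complete      = clique
marker starCenter    = centre
marker (starSpoke _) = leaf

q0Marker : Q0Shape k → Fin k → Marker
q0Marker complete i = clique
q0Marker (star j) i = if i ==F j then centre else leaf

compatible : Marker → Marker → Bool
compatible clique clique = false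
compatible centre leaf   = false
compatible leaf   centre = false
compatible _      _      = true

Reduced : SplitDecomp k n → Set
Reduced D = ∀ i → T (compatible (q0Marker (Q0 D) i) (marker (Q D i)))

reduced-complementLeaf : (a : Fin k) (c : Fin n) (P : Q0Shape k) (R : QShape n) →
  T (compatible (q0Marker P a) (marker R)) →
  T (compatible (q0Marker (if splitAdj R c then complementQ0 a P else P) a) (marker (complementLeaf c R)))
reduced-complementLeaf a c complete starCenter _ rewrite ==F-refl a = tt
reduced-complementLeaf a c complete (starSpoke c′) _ with c ≟ c′
... | yes refl rewrite ==F-refl a = tt
... | no _ = tt
reduced-complementLeaf a c (star j) R h with a ≟ j
reduced-complementLeaf a c (star a) complete _ | yes refl rewrite ==F-refl a = tt
reduced-complementLeaf a c (star a) starCenter _ | yes refl rewrite ==F-refl a = tt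
reduced-complementLeaf a c (star j) complete _ | no a≢j rewrite ==F-≢ (a≢j ∘ sym) | ==F-≢ a≢j = tt
reduced-complementLeaf a c (star j) (starSpoke c′) _ | no a≢j with c ≟ c′
... | yes refl rewrite ==F-≢ (a≢j ∘ sym) | ==F-≢ a≢j = tt
... | no _ rewrite ==F-≢ a≢j = tt

reduced-complementSplit : (t : Bool) (a : Fin k) (P : Q0Shape k) (R : QShape n) {l : Fin k} → l ≢ a →
  T (compatible (q0Marker P l) (marker R)) →
  T (compatible (q0Marker (if t then complementQ0 a P else P) l)
                (marker (if t ∧ q0Adj P a l then complementSplit R else R)))
reduced-complementSplit false a P R l≢a h = h
reduced-complementSplit true a complete starCenter l≢a _ rewrite ==F-≢ l≢a = tt
reduced-complementSplit true a complete (starSpoke _) l≢a _ rewrite ==F-≢ l≢a = tt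
reduced-complementSplit true a (star j) R {l} l≢a h with j ≟ a | l ≟ j | R
... | yes refl | yes refl | _ = ⊥-elim (l≢a refl)
... | yes refl | no _ | complete rewrite ==F-refl j = tt
... | yes refl | no _ | starSpoke _ rewrite ==F-refl j = tt
... | no j≢a | yes refl | complete rewrite ==F-≢ (j≢a ∘ sym) | ==F-refl j = tt
... | no j≢a | yes refl | starCenter rewrite ==F-≢ (j≢a ∘ sym) | ==F-refl j = tt
... | no j≢a | no l≢j | _ rewrite ==F-≢ (j≢a ∘ sym) | ==F-≢ l≢j = h

reduced-localCompDecomp : (w : Vtx k n) (D : SplitDecomp k n) → Reduced D → Reduced (localCompDecomp w D)
reduced-localCompDecomp (a , c) D red l = reducedAt l (l ≟ a)
  where
  open LocalCompAt a c D using (Q′-pivot; Q′-away)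
  reducedAt : ∀ l → Dec (l ≡ a) → T (compatible (q0Marker (Q0 (localCompDecomp (a , c) D)) l)
                                                (marker (Q (localCompDecomp (a , c) D) l)))
  reducedAt a (yes refl) rewrite Q′-pivot = reduced-complementLeaf a c (Q0 D) (Q D a) (red a)
  reducedAt l (no l≢a) rewrite Q′-away l≢a =
    reduced-complementSplit (splitAdj (Q D a) c) a (Q0 D) (Q D l) l≢a (red l)

completeDecomp : SplitDecomp k n
completeDecomp = decomp complete (λ _ → starCenter)

completeMultipartite-graphOf : (x y : Vtx k n) →
  completeMultipartite k n x y ≡ graphOf completeDecomp x y
completeMultipartite-graphOf (i , u) (l , v) with i ≟ l
... | yes refl with u ≟ v
...   | yes _ = refl
...   | no _ = refl
completeMultipartite-graphOf (i , u) (l , v) | no _ = refl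

localComps-graphOf : (vs : List (Vtx k n)) (H : Graph (Vtx k n)) (D : SplitDecomp k n) →
  Reduced D → (∀ x y → H x y ≡ graphOf D x y) →
  Σ (SplitDecomp k n) λ D′ → Reduced D′ × (∀ x y → localComps vs H x y ≡ graphOf D′ x y)
localComps-graphOf [] H D red H≡ = D , red , H≡
localComps-graphOf (w ∷ vs) H D red H≡ =
  localComps-graphOf vs (localComp w H) (localCompDecomp w D) (reduced-localCompDecomp w D red)
    (λ x y → trans (localComp-cong w H≡ x y) (localComp-graphOf w D x y))

orbit-reduced : {G : Graph (Vtx k n)} → InOrbit (completeMultipartite k n) G →
  Σ (SplitDecomp k n) λ D → Reduced D × (∀ x y → G x y ≡ graphOf D x y)
orbit-reduced (vs , G≡) with localComps-graphOf vs _ completeDecomp (λ _ → tt) completeMultipartite-graphOf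
... | D , red , eq = D , red , λ x y → trans (G≡ x y) (eq x y)

-- Uniqueness of the decomposition

otherThan : 2 ≤ m → (c : Fin m) → Σ (Fin m) λ u → u ≢ c
otherThan (s≤s (s≤s z≤n)) c = punchIn c zero , punchInᵢ≢i c zero

thirdElement : 3 ≤ m → (a b : Fin m) → Σ (Fin m) λ c → c ≢ a × c ≢ b
thirdElement (s≤s (s≤s (s≤s z≤n))) a b with b ≟ a
... | yes refl = punchIn a zero , punchInᵢ≢i a zero , punchInᵢ≢i a zero
... | no b≢a = punchIn a (punchIn b′ zero) , punchInᵢ≢i a _ , c≢b
  where
  b′ = punchOut (≢-sym b≢a)
  c≢b : punchIn a (punchIn b′ zero) ≢ b
  c≢b c≡b = punchInᵢ≢i b′ zero
    (punchIn-injective a _ _ (trans c≡b (sym (punchIn-punchOut (≢-sym b≢a)))))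

splitNeighbour : (R : QShape n) → Fin n → Σ (Fin n) λ v → splitAdj R v ≡ true
splitNeighbour complete      u = u , refl
splitNeighbour starCenter    u = u , refl
splitNeighbour (starSpoke c) _ = c , ==F-refl c

q0Neighbour : 2 ≤ k → (P : Q0Shape k) (i : Fin k) → Σ (Fin k) λ l → i ≢ l × q0Adj P i l ≡ true
q0Neighbour k≥2 complete i = let l , l≢i = otherThan k≥2 i in l , ≢-sym l≢i , refl
q0Neighbour k≥2 (star j) i with i ≟ j
... | yes refl = let l , l≢i = otherThan k≥2 i in l , ≢-sym l≢i , refl
... | no i≢j = j , i≢j , ==F-refl j

qShape-unique : 2 ≤ n → (R R′ : QShape n) → (∀ u → splitAdj R u ≡ splitAdj R′ u) →
  (∀ {u v} → u ≢ v → leafAdj R u v ≡ leafAdj R′ u v) → R ≡ R′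
qShape-unique _ complete complete _ _ = refl
qShape-unique _ starCenter starCenter _ _ = refl
qShape-unique (s≤s (s≤s z≤n)) complete starCenter _ leaf≡ =
  contradiction (leaf≡ {zero} {suc zero} λ ()) λ ()
qShape-unique (s≤s (s≤s z≤n)) starCenter complete _ leaf≡ =
  contradiction (leaf≡ {zero} {suc zero} λ ()) λ ()
qShape-unique _ (starSpoke c) (starSpoke c′) split≡ _ =
  cong starSpoke (==F⇒≡ (trans (sym (split≡ c)) (==F-refl c)))
qShape-unique n≥2 (starSpoke c) complete split≡ _ =
  let u , u≢c = otherThan n≥2 c in contradiction (trans (sym (==F-≢ u≢c)) (split≡ u)) λ ()
qShape-unique n≥2 (starSpoke c) starCenter split≡ _ =
  let u , u≢c = otherThan n≥2 c in contradiction (trans (sym (==F-≢ u≢c)) (split≡ u)) λ ()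
qShape-unique n≥2 complete (starSpoke c) split≡ _ =
  let u , u≢c = otherThan n≥2 c in contradiction (trans (split≡ u) (==F-≢ u≢c)) λ ()
qShape-unique n≥2 starCenter (starSpoke c) split≡ _ =
  let u , u≢c = otherThan n≥2 c in contradiction (trans (split≡ u) (==F-≢ u≢c)) λ ()

q0Shape-unique : 3 ≤ k → (P P′ : Q0Shape k) →
  (∀ {i l} → i ≢ l → q0Adj P i l ≡ q0Adj P′ i l) → P ≡ P′
q0Shape-unique _ complete complete _ = refl
q0Shape-unique k≥3 complete (star j) q0≡ =
  let i , i≢j , _ = thirdElement k≥3 j j
      l , l≢j , l≢i = thirdElement k≥3 j i
  in contradiction (trans (q0≡ (≢-sym l≢i)) (cong₂ _∨_ (==F-≢ i≢j) (==F-≢ l≢j))) λ ()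
q0Shape-unique k≥3 (star j) complete q0≡ =
  let i , i≢j , _ = thirdElement k≥3 j j
      l , l≢j , l≢i = thirdElement k≥3 j i
  in contradiction (trans (sym (q0≡ (≢-sym l≢i))) (cong₂ _∨_ (==F-≢ i≢j) (==F-≢ l≢j))) λ ()
q0Shape-unique k≥3 (star j) (star j′) q0≡ with j ≟ j′
... | yes refl = refl
... | no j≢j′ =
  let l , l≢j , l≢j′ = thirdElement k≥3 j j′
  in contradiction (trans (sym (cong (_∨ (l ==F j)) (==F-refl j)))
                     (trans (q0≡ (≢-sym l≢j)) (cong₂ _∨_ (==F-≢ j≢j′) (==F-≢ l≢j′)))) λ ()

SameGraph : SplitDecomp k n → SplitDecomp k n → Set
SameGraph D D′ = ∀ x y → graphOf D x y ≡ graphOf D′ x y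

splitAdj-transfer : 2 ≤ k → {D D′ : SplitDecomp k n} → SameGraph D D′ → (i : Fin k) (u : Fin n) →
  splitAdj (Q D i) u ≡ true → splitAdj (Q D′ i) u ≡ true
splitAdj-transfer k≥2 {D} {D′} same i u su = ∧-conicalˡ _ _ (begin
  splitAdj (Q D′ i) u ∧ q0Adj (Q0 D′) i l ∧ splitAdj (Q D′ l) v ≡⟨ sym (graphOf-crossPart D′ u v i≢l) ⟩
  graphOf D′ (i , u) (l , v)                                    ≡⟨ sym (same (i , u) (l , v)) ⟩
  graphOf D (i , u) (l , v)                                     ≡⟨ graphOf-crossPart D u v i≢l ⟩
  splitAdj (Q D i) u ∧ q0Adj (Q0 D) i l ∧ splitAdj (Q D l) v    ≡⟨ cong₂ _∧_ su (cong₂ _∧_ qil sv) ⟩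
  true                                                          ∎)
  where
  nbr = q0Neighbour k≥2 (Q0 D) i
  l = proj₁ nbr
  i≢l = proj₁ (proj₂ nbr)
  qil = proj₂ (proj₂ nbr)
  v = proj₁ (splitNeighbour (Q D l) u)
  sv = proj₂ (splitNeighbour (Q D l) u)

graphOf-crossPart-q0Adj : (D : SplitDecomp k n) {i l : Fin k} {u v : Fin n} → i ≢ l →
  splitAdj (Q D i) u ≡ true → splitAdj (Q D l) v ≡ true → graphOf D (i , u) (l , v) ≡ q0Adj (Q0 D) i l
graphOf-crossPart-q0Adj D {u = u} {v} i≢l su sv
  rewrite graphOf-crossPart D u v i≢l | su | sv = ∧-identityʳ _

graphOf-injective : 3 ≤ k → 2 ≤ n → {D D′ : SplitDecomp k n} → SameGraph D D′ →
  Q0 D ≡ Q0 D′ × (∀ i → Q D i ≡ Q D′ i)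
graphOf-injective k≥3 n≥2@(s≤s (s≤s z≤n)) {D} {D′} same = q0Shape-unique k≥3 _ _ q0Adj≡ , Q≡
  where
  k≥2 : 2 ≤ _
  k≥2 = ≤-trans (s≤s (s≤s z≤n)) k≥3
  transfer : ∀ i u → splitAdj (Q D i) u ≡ true → splitAdj (Q D′ i) u ≡ true
  transfer = splitAdj-transfer k≥2 {D} {D′} same
  transfer⁻¹ : ∀ i u → splitAdj (Q D′ i) u ≡ true → splitAdj (Q D i) u ≡ true
  transfer⁻¹ = splitAdj-transfer k≥2 {D′} {D} (λ x y → sym (same x y))
  Q≡ : ∀ i → Q D i ≡ Q D′ i
  Q≡ i = qShape-unique n≥2 (Q D i) (Q D′ i)
    (λ u → ⇔→≡ (mk⇔ (transfer i u) (transfer⁻¹ i u)))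
    (λ {u} {v} u≢v → trans (sym (graphOf-samePart-≢ D i u≢v))
                     (trans (same (i , u) (i , v)) (graphOf-samePart-≢ D′ i u≢v)))
  q0Adj≡ : ∀ {i l} → i ≢ l → q0Adj (Q0 D) i l ≡ q0Adj (Q0 D′) i l
  q0Adj≡ {i} {l} i≢l =
    trans (sym (graphOf-crossPart-q0Adj D i≢l su sv))
      (trans (same (i , _) (l , _)) (graphOf-crossPart-q0Adj D′ i≢l (transfer i _ su) (transfer l _ sv)))
    where
    su = proj₂ (splitNeighbour (Q D i) zero)
    sv = proj₂ (splitNeighbour (Q D l) zero)

describes-graphOf : {G : Graph (Vtx k n)} (D : SplitDecomp k n) → (∀ x → G x x ≡ false) →
  Describes D G → ∀ x y → G x y ≡ graphOf D x y
describes-graphOf D irrefl desc x y with x ≟V y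
... | yes refl = irrefl x
... | no x≢y = desc x y x≢y

orbit-describes : 3 ≤ k → 2 ≤ n → {G : Graph (Vtx k n)} {D : SplitDecomp k n} →
  InOrbit (completeMultipartite k n) G → Describes D G →
  Reduced D × (∀ x y → G x y ≡ graphOf D x y)
orbit-describes k≥3 n≥2 {G} {D} orb desc = reduced , G≡D
  where
  D₀ = proj₁ (orbit-reduced orb)
  G≡D₀ = proj₂ (proj₂ (orbit-reduced orb))
  G≡D : ∀ x y → G x y ≡ graphOf D x y
  G≡D = describes-graphOf D (λ x → trans (G≡D₀ x x) (graphOf-diag D₀ x)) desc
  D≡D₀ = graphOf-injective k≥3 n≥2 {D} {D₀} (λ x y → trans (sym (G≡D x y)) (G≡D₀ x y))
  reduced : Reduced D
  reduced i = subst₂ (λ P R → T (compatible (q0Marker P i) (marker R)))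
    (sym (proj₁ D≡D₀)) (sym (proj₂ D≡D₀ i)) (proj₁ (proj₂ (orbit-reduced orb)) i)

-- Permutations with prescribed values

count : (Fin m → Bool) → ℕ
count b = ∣ tabulate b ∣

∣∷∣-swap : (x y : Bool) (v : Subset m) → ∣ x ∷ y ∷ v ∣ ≡ ∣ y ∷ x ∷ v ∣
∣∷∣-swap true  true  v = refl
∣∷∣-swap true  false v = refl
∣∷∣-swap false true  v = refl
∣∷∣-swap false false v = refl

∣∷∣-cong : (x : Bool) (v w : Subset m) → ∣ v ∣ ≡ ∣ w ∣ → ∣ x ∷ v ∣ ≡ ∣ x ∷ w ∣
∣∷∣-cong true  v w eq = cong ℕ.suc eq
∣∷∣-cong false v w eq = eq

∣∷∣-cancel : (x : Bool) (v w : Subset m) → ∣ x ∷ v ∣ ≡ ∣ x ∷ w ∣ → ∣ v ∣ ≡ ∣ w ∣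
∣∷∣-cancel true  v w eq = suc-injective eq
∣∷∣-cancel false v w eq = eq

count-punchIn : (b : Fin (ℕ.suc m) → Bool) (p : Fin (ℕ.suc m)) →
  count b ≡ ∣ b p ∷ tabulate (b ∘ punchIn p) ∣
count-punchIn b zero = refl
count-punchIn {ℕ.suc m} b (suc p) =
  trans (∣∷∣-cong (b zero) (tabulate (b ∘ suc)) (b (suc p) ∷ rest) (count-punchIn (b ∘ suc) p))
        (∣∷∣-swap (b zero) (b (suc p)) rest)
  where rest = tabulate (b ∘ suc ∘ punchIn p)

count>0⇒true : (b : Fin m → Bool) → 1 ≤ count b → Σ (Fin m) λ p → b p ≡ true
count>0⇒true {ℕ.suc m} b h with b zero in b0
... | true = zero , b0
... | false = let p , bp = count>0⇒true (b ∘ suc) h in suc p , bp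

count<⇒false : (b : Fin m → Bool) → count b < m → Σ (Fin m) λ p → b p ≡ false
count<⇒false {ℕ.suc m} b h with b zero in b0
... | false = zero , b0
... | true = let p , bp = count<⇒false (b ∘ suc) (s<s⁻¹ h) in suc p , bp

permute-count : (b b′ : Fin m → Bool) → count b ≡ count b′ →
  Σ (Permutation m m) λ π → ∀ i → b i ≡ b′ (π ⟨$⟩ʳ i)

permute-count-fixing : (b b′ : Fin m → Bool) (j j′ : Fin m) → b j ≡ b′ j′ → count b ≡ count b′ →
  Σ (Permutation m m) λ π → (∀ i → b i ≡ b′ (π ⟨$⟩ʳ i)) × π ⟨$⟩ʳ j ≡ j′
permute-count-fixing {ℕ.suc m} b b′ j j′ bj≡b′j′ eq = π , π-ok , π-fixes
  where
  tails : count (b ∘ punchIn j) ≡ count (b′ ∘ punchIn j′)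
  tails = ∣∷∣-cancel (b j) (tabulate (b ∘ punchIn j)) (tabulate (b′ ∘ punchIn j′)) (begin
    ∣ b j ∷ tabulate (b ∘ punchIn j) ∣     ≡⟨ sym (count-punchIn b j) ⟩
    count b                                ≡⟨ eq ⟩
    count b′                               ≡⟨ count-punchIn b′ j′ ⟩
    ∣ b′ j′ ∷ tabulate (b′ ∘ punchIn j′) ∣ ≡⟨ cong (λ x → ∣ x ∷ tabulate (b′ ∘ punchIn j′) ∣)
                                                   (sym bj≡b′j′) ⟩
    ∣ b j ∷ tabulate (b′ ∘ punchIn j′) ∣   ∎)
  rest : Σ (Permutation _ _) λ π → ∀ i → b (punchIn j i) ≡ b′ (punchIn j′ (π ⟨$⟩ʳ i))
  rest = permute-count (b ∘ punchIn j) (b′ ∘ punchIn j′) tails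
  π = Perm.insert j j′ (proj₁ rest)
  π-ok : ∀ i → b i ≡ b′ (π ⟨$⟩ʳ i)
  π-ok i with j ≟ i
  ... | yes refl = bj≡b′j′
  ... | no j≢i = trans (cong b (sym (punchIn-punchOut j≢i))) (proj₂ rest (punchOut j≢i))
  π-fixes : π ⟨$⟩ʳ j ≡ j′
  π-fixes with j ≟ j
  ... | yes _ = refl
  ... | no j≢j = ⊥-elim (j≢j refl)

permute-count {ℕ.zero} b b′ eq = Perm.id , λ ()
permute-count {ℕ.suc m} b b′ eq =
  let π , π-ok , _ = permute-count-fixing b b′ zero (proj₁ partner) (sym (proj₂ partner)) eq
  in π , π-ok
  where
  partner : Σ (Fin (ℕ.suc m)) λ p → b′ p ≡ b zero
  partner with b zero in b0
  ... | true = count>0⇒true b′ (subst (1 ≤_) eq (s≤s z≤n))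
  ... | false = count<⇒false b′ (subst (_< ℕ.suc m) eq (s≤s (∣p∣≤n (tabulate (b ∘ suc)))))

permute-≢ : (π : Permutation m m) {i j : Fin m} → i ≢ j → π ⟨$⟩ʳ i ≢ π ⟨$⟩ʳ j
permute-≢ π i≢j = i≢j ∘ Injection.injective (↔⇒↣ π)

==F-permute : (π : Permutation m m) {j j′ : Fin m} → π ⟨$⟩ʳ j ≡ j′ →
  (i : Fin m) → (i ==F j) ≡ ((π ⟨$⟩ʳ i) ==F j′)
==F-permute π {j} πj≡j′ i with i ≟ j
... | yes refl rewrite πj≡j′ = sym (==F-refl _)
... | no i≢j = sym (==F-≢ (permute-≢ π i≢j ∘ flip trans (sym πj≡j′)))

-- Isomorphisms between matched decompositions

data ShapeMatch {n : ℕ} : QShape n → QShape n → Set where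
  complete   : ShapeMatch complete complete
  starCenter : ShapeMatch starCenter starCenter
  starSpoke  : (c c′ : Fin n) → ShapeMatch (starSpoke c) (starSpoke c′)

shapeMatch-refl : (R : QShape n) → ShapeMatch R R
shapeMatch-refl complete      = complete
shapeMatch-refl starCenter    = starCenter
shapeMatch-refl (starSpoke c) = starSpoke c c

leafPerm : {R R′ : QShape n} → ShapeMatch R R′ → Permutation n n
leafPerm complete           = Perm.id
leafPerm starCenter         = Perm.id
leafPerm (starSpoke c c′)   = Perm.transpose c c′

==F-transpose : (c c′ u : Fin m) → (u ==F c) ≡ ((Perm.transpose c c′ ⟨$⟩ʳ u) ==F c′)
==F-transpose c c′ u with u ≟ c
... | yes refl = sym (==F-refl c′)
... | no u≢c with u ≟ c′
...   | yes refl = sym (==F-≢ (u≢c ∘ sym))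
...   | no u≢c′ = sym (==F-≢ u≢c′)

splitAdj-leafPerm : {R R′ : QShape n} (M : ShapeMatch R R′) (u : Fin n) →
  splitAdj R u ≡ splitAdj R′ (leafPerm M ⟨$⟩ʳ u)
splitAdj-leafPerm complete         u = refl
splitAdj-leafPerm starCenter       u = refl
splitAdj-leafPerm (starSpoke c c′) u = ==F-transpose c c′ u

leafAdj-leafPerm : {R R′ : QShape n} (M : ShapeMatch R R′) (u v : Fin n) →
  leafAdj R u v ≡ leafAdj R′ (leafPerm M ⟨$⟩ʳ u) (leafPerm M ⟨$⟩ʳ v)
leafAdj-leafPerm complete         u v = refl
leafAdj-leafPerm starCenter       u v = refl
leafAdj-leafPerm (starSpoke c c′) u v = cong₂ _∨_ (==F-transpose c c′ u) (==F-transpose c c′ v)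

record PartMatching (D D′ : SplitDecomp k n) : Set where
  field
    perm  : Permutation k k
    match : ∀ i → ShapeMatch (Q D i) (Q D′ (perm ⟨$⟩ʳ i))
    q0Adj-perm : ∀ i l → q0Adj (Q0 D) i l ≡ q0Adj (Q0 D′) (perm ⟨$⟩ʳ i) (perm ⟨$⟩ʳ l)

module _ {D D′ : SplitDecomp k n} (M : PartMatching D D′) where
  open PartMatching M

  relabel : Vtx k n ↔ Vtx k n
  relabel = Σ-↔ perm (λ {i} → leafPerm (match i))

  private
    σ : Fin k → Permutation n n
    σ i = leafPerm (match i)

    byCases : ∀ i u l v → Dec (i ≡ l) → Dec (u ≡ v) →
      graphOf D (i , u) (l , v) ≡ graphOf D′ (perm ⟨$⟩ʳ i , σ i ⟨$⟩ʳ u) (perm ⟨$⟩ʳ l , σ l ⟨$⟩ʳ v)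
    byCases i u i u (yes refl) (yes refl) =
      trans (graphOf-diag D (i , u)) (sym (graphOf-diag D′ (perm ⟨$⟩ʳ i , σ i ⟨$⟩ʳ u)))
    byCases i u i v (yes refl) (no u≢v) = begin
      graphOf D (i , u) (i , v)                          ≡⟨ graphOf-samePart-≢ D i u≢v ⟩
      leafAdj (Q D i) u v                                ≡⟨ leafAdj-leafPerm (match i) u v ⟩
      leafAdj (Q D′ (perm ⟨$⟩ʳ i)) (σ i ⟨$⟩ʳ u) (σ i ⟨$⟩ʳ v)
        ≡⟨ sym (graphOf-samePart-≢ D′ _ (permute-≢ (σ i) u≢v)) ⟩
      graphOf D′ (perm ⟨$⟩ʳ i , σ i ⟨$⟩ʳ u) (perm ⟨$⟩ʳ i , σ i ⟨$⟩ʳ v) ∎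
    byCases i u l v (no i≢l) _ = begin
      graphOf D (i , u) (l , v)
        ≡⟨ graphOf-crossPart D u v i≢l ⟩
      splitAdj (Q D i) u ∧ q0Adj (Q0 D) i l ∧ splitAdj (Q D l) v
        ≡⟨ cong₂ _∧_ (splitAdj-leafPerm (match i) u)
             (cong₂ _∧_ (q0Adj-perm i l) (splitAdj-leafPerm (match l) v)) ⟩
      splitAdj (Q D′ (perm ⟨$⟩ʳ i)) (σ i ⟨$⟩ʳ u) ∧ q0Adj (Q0 D′) (perm ⟨$⟩ʳ i) (perm ⟨$⟩ʳ l)
        ∧ splitAdj (Q D′ (perm ⟨$⟩ʳ l)) (σ l ⟨$⟩ʳ v)
        ≡⟨ sym (graphOf-crossPart D′ _ _ (permute-≢ perm i≢l)) ⟩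
      graphOf D′ (perm ⟨$⟩ʳ i , σ i ⟨$⟩ʳ u) (perm ⟨$⟩ʳ l , σ l ⟨$⟩ʳ v) ∎

  graphOf-relabel : ∀ x y → graphOf D x y ≡ graphOf D′ (Inverse.to relabel x) (Inverse.to relabel y)
  graphOf-relabel (i , u) (l , v) = byCases i u l v (i ≟ l) (u ≟ v)

-- Matching decompositions of the same symmetry class

reduced-shapeMatch : (m : Marker) {R R′ : QShape n} → m ≢ centre →
  T (compatible m (marker R)) → T (compatible m (marker R′)) → isSpoke R ≡ isSpoke R′ → ShapeMatch R R′
reduced-shapeMatch m      {complete}    {complete}     _ _ _ _ = complete
reduced-shapeMatch m      {starCenter}  {starCenter}   _ _ _ _ = starCenter
reduced-shapeMatch m      {starSpoke c} {starSpoke c′} _ _ _ _ = starSpoke c c′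
reduced-shapeMatch centre {complete}    {starCenter}   m≢centre _ _ _ = ⊥-elim (m≢centre refl)
reduced-shapeMatch centre {starCenter}  {complete}     m≢centre _ _ _ = ⊥-elim (m≢centre refl)

reduced-star-leaf : {D : SplitDecomp k n} {i j : Fin k} → Reduced D → Q0 D ≡ star j → i ≢ j →
  T (compatible leaf (marker (Q D i)))
reduced-star-leaf {D = decomp _ Qs} {i} red refl i≢j =
  subst (λ b → T (compatible (if b then centre else leaf) (marker (Qs i)))) (==F-≢ i≢j) (red i)

completeMatching : {D D′ : SplitDecomp k n} → Reduced D → Reduced D′ →
  Q0 D ≡ complete → Q0 D′ ≡ complete → ∣ spokeSet D ∣ ≡ ∣ spokeSet D′ ∣ → PartMatching D D′
completeMatching {D = decomp _ Qs} {decomp _ Qs′} red red′ refl refl eq = record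
  { perm = π
  ; match = λ i → reduced-shapeMatch clique (λ ()) (red i) (red′ (π ⟨$⟩ʳ i)) (proj₂ spokes i)
  ; q0Adj-perm = λ _ _ → refl
  }
  where
  spokes = permute-count (isSpoke ∘ Qs) (isSpoke ∘ Qs′) eq
  π = proj₁ spokes

starMatching : {D D′ : SplitDecomp k n} (S : QShape n) {j j′ : Fin k} → Reduced D → Reduced D′ →
  Q0 D ≡ star j → Q D j ≡ S → Q0 D′ ≡ star j′ → Q D′ j′ ≡ S →
  ∣ spokeSet D ∣ ≡ ∣ spokeSet D′ ∣ → PartMatching D D′
starMatching {D = D@(decomp _ Qs)} {D′@(decomp _ Qs′)} S {j} {j′} red red′ refl Qj≡S refl Qj′≡S eq = record
  { perm = π
  ; match = λ i → byPart i (i ≟ j)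
  ; q0Adj-perm = λ i l → cong₂ _∨_ (==F-permute π πj≡j′ i) (==F-permute π πj≡j′ l)
  }
  where
  spokes = permute-count-fixing (isSpoke ∘ Qs) (isSpoke ∘ Qs′) j j′
             (cong isSpoke (trans Qj≡S (sym Qj′≡S))) eq
  π = proj₁ spokes
  πj≡j′ = proj₂ (proj₂ spokes)
  byPart : ∀ i → Dec (i ≡ j) → ShapeMatch (Qs i) (Qs′ (π ⟨$⟩ʳ i))
  byPart i (yes refl) =
    subst₂ ShapeMatch (sym Qj≡S) (sym (trans (cong Qs′ πj≡j′) Qj′≡S)) (shapeMatch-refl S)
  byPart i (no i≢j) = reduced-shapeMatch leaf (λ ())
    (reduced-star-leaf {D = D} red refl i≢j)
    (reduced-star-leaf {D = D′} red′ refl (permute-≢ π i≢j ∘ flip trans (sym πj≡j′)))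
    (proj₁ (proj₂ spokes) i)

sameClass-matching : {D D′ : SplitDecomp k n} → Reduced D → Reduced D′ → SameClass D D′ →
  ∣ spokeSet D ∣ ≡ ∣ spokeSet D′ ∣ → PartMatching D D′
sameClass-matching red red′ (inj₁ (e , e′)) =
  completeMatching red red′ e e′
sameClass-matching red red′ (inj₂ (inj₁ ((_ , e , Qj≡S) , (_ , e′ , Qj′≡S)))) =
  starMatching starCenter red red′ e Qj≡S e′ Qj′≡S
sameClass-matching red red′ (inj₂ (inj₂ ((_ , e , Qj≡S) , (_ , e′ , Qj′≡S)))) =
  starMatching complete red red′ e Qj≡S e′ Qj′≡S

lemma7 : (k n : ℕ) → 3 ≤ k → 2 ≤ n →
    (G G' : Graph (Vtx k n)) →
    InOrbit (completeMultipartite k n) G →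
    InOrbit (completeMultipartite k n) G' →
    (D D' : SplitDecomp k n) →
    Describes D G → Describes D' G' →
    SameClass D D' →
    ∣ spokeSet D ∣ ≡ ∣ spokeSet D' ∣ →
    Isomorphic G G'
lemma7 k n k≥3 n≥2 G G′ orb orb′ D D′ desc desc′ sameClass sameSpokes =
  relabel M , λ x y → trans (G≡D x y) (trans (graphOf-relabel M x y) (sym (G′≡D′ _ _)))
  where
  D-canonical = orbit-describes k≥3 n≥2 {G} {D} orb desc
  D′-canonical = orbit-describes k≥3 n≥2 {G′} {D′} orb′ desc′
  G≡D = proj₂ D-canonical
  G′≡D′ = proj₂ D′-canonical
  M = sameClass-matching {D = D} {D′} (proj₁ D-canonical) (proj₁ D′-canonical) sameClass sameSpokes
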